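{- Let $b\ge 2$, $m\ge1$ be integers, $\Sigma$ an alphabet with $m$ letters, $\sigma$ a cyclic permutation of $\Sigma$ (a single $m$-cycle), $\overline{\alpha}\in\Sigma$, and $\mathbf{t}$ the corresponding generalized Thue–Morse word. Let $w=w_0w_1\cdots w_{\ell-1}$ be a factor of $\mathbf{t}$ with $b\nmid\ell$. Then: (i) if $wp$ is a factor of $\mathbf{t}$, where $p$ is a prefix of $w$, then $p$ is $\sigma$-cyclic; (ii) if $w^e$ is a factor of $\mathbf{t}$ for some rational $e>2$ (with $e\ell\in\mathbb N$), then $w^e$ is $\sigma$-cyclic.
   Context: $\mu(\alpha)=\alpha\,\sigma(\alpha)\cdots\sigma^{b-1}(\alpha)$, $\mathbf{t}=\lim_n\mu^n(\overline{\alpha})$; equivalently $\mathbf{t}[n]=\sigma^{s_b(n)}(\overline{\alpha})$ with $s_b(n)$ the base-$b$ digit sum of $n$. A word $u_0\cdots u_{k-1}$ is $\sigma$-cyclic if $u_i=\sigma(u_{i-1})$ for $1\le i\le k-1$. For rational $r>0$ with $r|w|\in\mathbb N$, $w^r=w^{\lfloor r\rfloor}q$ with $q$ the prefix of $w$ of length $(r-\lfloor r\rfloor)|w|$. -}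

module Defs where

open import Data.Nat using (ℕ; zero; suc; _+_; _*_; NonZero)
open import Data.Nat.DivMod using (_%_; _/_)
open import Data.Fin using (Fin)
open import Data.List using (List; []; _∷_; take; concat; replicate)
open import Data.Product using (∃; ∃-syntax)
open import Function using (_∘_)
open import Function.Definitions using (Injective)
open import Relation.Binary.PropositionalEquality using (_≡_)

iter : {A : Set} → (A → A) → ℕ → A → A
iter f zero    x = x
iter f (suc k) x = f (iter f k x)

-- base-b digit sum, computed with fuel (fuel n suffices since n / b < n for n > 0, b ≥ 2)
digitSumFuel : ℕ → (b : ℕ) → .{{NonZero b}} → ℕ → ℕ
digitSumFuel zero     b n = 0
digitSumFuel (suc f)  b n = n % b + digitSumFuel f b (n / b)

-- s_b(n); the value for b ∈ {0,1} is irrelevant (the theorem assumes b ≥ 2)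
digitSum : ℕ → ℕ → ℕ
digitSum zero    n = 0
digitSum (suc k) n = digitSumFuel n (suc k) n

IsCyclicPerm : {m : ℕ} → (Fin m → Fin m) → Set
IsCyclicPerm {m} σ = Injective _≡_ _≡_ σ × (∀ x y → ∃[ k ] iter σ k x ≡ y)
  where open import Data.Product using (_×_)

thueMorse : {m : ℕ} → ℕ → (Fin m → Fin m) → Fin m → ℕ → Fin m
thueMorse b σ α n = iter σ (digitSum b n) α

slice : {A : Set} → (ℕ → A) → ℕ → ℕ → List A
slice t i zero    = []
slice t i (suc n) = t i ∷ slice t (suc i) n

IsFactor : {A : Set} → (ℕ → A) → List A → Set
IsFactor t u = ∃[ i ] slice t i (Data.List.length u) ≡ u
  where import Data.List

IsPrefix : {A : Set} → List A → List A → Set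
IsPrefix p w = ∃[ s ] w ≡ p Data.List.++ s
  where import Data.List

data SigmaCyclic {A : Set} (σ : A → A) : List A → Set where
  nil  : SigmaCyclic σ []
  one  : ∀ x → SigmaCyclic σ (x ∷ [])
  cons : ∀ x y r → y ≡ σ x → SigmaCyclic σ (y ∷ r) → SigmaCyclic σ (x ∷ y ∷ r)

-- fractional power w^e with e = N / |w|: the prefix of length N of w w w ⋯
-- (for |w| ≥ 1, N copies of w have length ≥ N, so this is w^{⌊e⌋} q)
fracPow : {A : Set} → List A → ℕ → List A
fracPow w N = take N (concat (replicate N w))

-- A step t[n+1] = σ(t[n]) can only fail when b divides n+1, since only then does adding 1
-- to n produce a carry in base b. If a factor of t has period ℓ with b ∤ ℓ, then b cannot
-- divide both n+1 and n+1+ℓ, so every step inside the periodic part agrees with a shifted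
-- step that is not a carry; hence the part of the factor after its first period is σ-cyclic.
-- For wp this part is p. For w^e with e > 2 the part after the first period is longer than
-- the period, so it overlaps the first period by at least one letter and w^e is σ-cyclic.
module Submission where

open import Defs
open import Data.Nat using (ℕ; _≤_; _<_; _*_)
open import Data.Nat.Divisibility using (_∣_)
open import Data.Fin using (Fin)
open import Data.List using (List; length; _++_)
open import Data.Product using (_×_)
open import Relation.Nullary using (¬_)

open import Data.Nat using (zero; suc; _+_; _∸_; _⊓_; z≤n; s≤s; s≤s⁻¹; NonZero; ≢-nonZero; _%_; _/_)
open import Data.Nat.DivMod using (m%n<n; m≡m%n+[m/n]*n; %-distribˡ-+; m<n⇒m%n≡m; +-distrib-/; m/n<m; m/n≤m)
open import Data.Nat.Divisibility using (divides; _∣?_; _∣0; ∣m+n∣m⇒∣n)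
open import Data.Nat.Properties
open import Algebra.Properties.CommutativeSemigroup +-commutativeSemigroup using (x∙yz≈y∙xz)
open import Data.List using ([]; _∷_; take; drop; concat; replicate)
open import Data.List.Properties using (++-assoc; ++-identityʳ; length-++; length-take; length-drop; take++drop≡id; drop-[]; ∷-injective)
open import Data.Product using (_,_; proj₁; proj₂; map₂)
open import Data.Sum using (inj₁; inj₂)
open import Relation.Binary.PropositionalEquality
open import Relation.Nullary using (yes; no; contradiction)

module _ {A : Set} where

  isPrefix-trans : {p q r : List A} → IsPrefix p q → IsPrefix q r → IsPrefix p r
  isPrefix-trans {p} (s , refl) (s′ , refl) = s ++ s′ , ++-assoc p s s′

  take-isPrefix : ∀ n (xs : List A) → IsPrefix (take n xs) xs
  take-isPrefix n xs = drop n xs , sym (take++drop≡id n xs)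

  isPrefix-drop⁺ : ∀ n {p q : List A} → IsPrefix p q → IsPrefix (drop n p) (drop n q)
  isPrefix-drop⁺ zero            pre        = pre
  isPrefix-drop⁺ (suc n) {[]}    _          = _ , refl
  isPrefix-drop⁺ (suc n) {x ∷ p} (s , refl) = isPrefix-drop⁺ n (s , refl)

  isPrefix-take⁺ : ∀ n {p q : List A} → IsPrefix p q → length p ≤ n → IsPrefix p (take n q)
  isPrefix-take⁺ n       {[]}    _          _         = _ , refl
  isPrefix-take⁺ (suc n) {x ∷ p} (s , refl) (s≤s p≤n) = map₂ (cong (x ∷_)) (isPrefix-take⁺ n (s , refl) p≤n)

  isPrefix-comparable : ∀ (p q : List A) {s s′} → p ++ s ≡ q ++ s′ → length p ≤ length q → IsPrefix p q
  isPrefix-comparable []      q       _ _         = q , refl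
  isPrefix-comparable (x ∷ p) (y ∷ q) e (s≤s p≤q) with ∷-injective e
  ... | refl , e′ = map₂ (cong (x ∷_)) (isPrefix-comparable p q e′ p≤q)

  drop-length-++ : ∀ (xs ys : List A) → drop (length xs) (xs ++ ys) ≡ ys
  drop-length-++ []       ys = refl
  drop-length-++ (x ∷ xs) ys = drop-length-++ xs ys

module _ {A : Set} {σ : A → A} where

  sigmaCyclic-prefix : {p u : List A} → IsPrefix p u → SigmaCyclic σ u → SigmaCyclic σ p
  sigmaCyclic-prefix {[]}        _          _                  = nil
  sigmaCyclic-prefix {x ∷ []}    _          _                  = one x
  sigmaCyclic-prefix {x ∷ y ∷ p} (s , refl) (cons _ _ _ y≡σx c) = cons x y p y≡σx (sigmaCyclic-prefix (s , refl) c)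

  sigmaCyclic-overlap : ∀ a y r → SigmaCyclic σ (a ++ y ∷ []) → SigmaCyclic σ (y ∷ r) → SigmaCyclic σ (a ++ y ∷ r)
  sigmaCyclic-overlap []          y r _                    c = c
  sigmaCyclic-overlap (x ∷ [])    y r (cons _ _ _ y≡σx _)  c = cons x y r y≡σx c
  sigmaCyclic-overlap (x ∷ z ∷ a) y r (cons _ _ _ z≡σx c′) c = cons x z (a ++ y ∷ r) z≡σx (sigmaCyclic-overlap (z ∷ a) y r c′ c)

  sigmaCyclic-border : ∀ a v → IsPrefix v (a ++ v) → length a < length v → SigmaCyclic σ v → SigmaCyclic σ (a ++ v)
  sigmaCyclic-border a (y ∷ r) (s , e) a<v c = sigmaCyclic-overlap a y r (sigmaCyclic-prefix ay-prefix c) c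
    where
    ay-prefix : IsPrefix (a ++ y ∷ []) (y ∷ r)
    ay-prefix = isPrefix-comparable (a ++ y ∷ []) (y ∷ r) (trans (++-assoc a (y ∷ []) r) e)
             (subst (_≤ length (y ∷ r)) (sym (trans (length-++ a) (+-comm (length a) 1))) a<v)

module _ {A : Set} where

  length-concat-replicate : ∀ n (w : List A) → length (concat (replicate n w)) ≡ n * length w
  length-concat-replicate zero    w = refl
  length-concat-replicate (suc n) w = trans (length-++ w) (cong (length w +_) (length-concat-replicate n w))

  concat-replicate-comm : ∀ n (w : List A) → w ++ concat (replicate n w) ≡ concat (replicate n w) ++ w
  concat-replicate-comm zero    w = ++-identityʳ w
  concat-replicate-comm (suc n) w =
    trans (cong (w ++_) (concat-replicate-comm n w)) (sym (++-assoc w (concat (replicate n w)) w))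

  concat-replicate-period : ∀ n (w : List A) → IsPrefix (drop (length w) (concat (replicate n w))) (concat (replicate n w))
  concat-replicate-period zero    w = subst (λ v → IsPrefix v []) (sym (drop-[] (length w))) ([] , refl)
  concat-replicate-period (suc n) w =
    subst (λ v → IsPrefix v (w ++ wⁿ)) (sym (drop-length-++ w wⁿ)) (w , concat-replicate-comm n w)
    where wⁿ = concat (replicate n w)

  fracPow-period : ∀ (w : List A) N → IsPrefix (drop (length w) (fracPow w N)) (fracPow w N)
  fracPow-period w N = isPrefix-take⁺ N
    (isPrefix-trans (isPrefix-drop⁺ (length w) (take-isPrefix N wᴺ)) (concat-replicate-period N w))
    (begin
      length (drop (length w) (take N wᴺ)) ≡⟨ length-drop (length w) (take N wᴺ) ⟩
      length (take N wᴺ) ∸ length w        ≤⟨ m∸n≤m _ (length w) ⟩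
      length (take N wᴺ)                   ≡⟨ length-take N wᴺ ⟩
      N ⊓ length wᴺ                        ≤⟨ m⊓n≤m N _ ⟩
      N                                    ∎)
    where
    open ≤-Reasoning
    wᴺ = concat (replicate N w)

  length-fracPow : ∀ (w : List A) N → .{{NonZero (length w)}} → length (fracPow w N) ≡ N
  length-fracPow w N = trans (length-take N (concat (replicate N w)))
    (m≤n⇒m⊓n≡m (subst (N ≤_) (sym (length-concat-replicate N w)) (m≤m*n N (length w))))

module _ {A : Set} (f : ℕ → A) where

  drop-slice : ∀ ℓ i L → drop ℓ (slice f i L) ≡ slice f (ℓ + i) (L ∸ ℓ)
  drop-slice zero    i L       = refl
  drop-slice (suc ℓ) i zero    = refl
  drop-slice (suc ℓ) i (suc L) = trans (drop-slice ℓ (suc i) L) (cong (λ j → slice f j (L ∸ ℓ)) (+-suc ℓ i))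

  slice-sigmaCyclic : ∀ {σ : A → A} i L → (∀ k → suc k < L → f (suc k + i) ≡ σ (f (k + i))) → SigmaCyclic σ (slice f i L)
  slice-sigmaCyclic i zero          _    = nil
  slice-sigmaCyclic i (suc zero)    _    = one (f i)
  slice-sigmaCyclic {σ} i (suc (suc L)) step =
    cons (f i) (f (suc i)) _ (step 0 (s≤s (s≤s z≤n)))
      (slice-sigmaCyclic (suc i) (suc L) λ k k<L →
        subst (λ n → f (suc n) ≡ σ (f n)) (sym (+-suc k i)) (step (suc k) (s≤s k<L)))

  slice-isPrefix-pointwise : ∀ {i i′ L n} → IsPrefix (slice f i′ n) (slice f i L) → ∀ k → k < n → f (k + i) ≡ f (k + i′)
  slice-isPrefix-pointwise {L = zero}  {suc n} (_ , ())
  slice-isPrefix-pointwise {L = suc L} {suc n} (s , e) zero    _         = proj₁ (∷-injective e)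
  slice-isPrefix-pointwise {i} {i′} {suc L} {suc n} (s , e) (suc k) (s≤s k<n) =
    subst₂ (λ x y → f x ≡ f y) (+-suc k i) (+-suc k i′)
      (slice-isPrefix-pointwise (s , proj₂ (∷-injective e)) k k<n)

module ThueMorse (c : ℕ) {m : ℕ} (σ : Fin m → Fin m) (α : Fin m) where

  b : ℕ
  b = 2 + c

  t : ℕ → Fin m
  t = thueMorse b σ α

  /b<fuel : ∀ {n f} → n ≤ suc f → n / b ≤ f
  /b<fuel {zero}  _   = z≤n
  /b<fuel {suc n} n≤f = s≤s⁻¹ (<-≤-trans (m/n<m (suc n) b (s≤s (s≤s z≤n))) n≤f)

  digitSumFuel-irrelevant : ∀ f g n → n ≤ f → n ≤ g → digitSumFuel f b n ≡ digitSumFuel g b n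
  digitSumFuel-irrelevant zero    zero    n z≤n _   = refl
  digitSumFuel-irrelevant zero    (suc g) n z≤n _   = digitSumFuel-irrelevant zero g 0 z≤n z≤n
  digitSumFuel-irrelevant (suc f) zero    n _   z≤n = digitSumFuel-irrelevant f zero 0 z≤n z≤n
  digitSumFuel-irrelevant (suc f) (suc g) n n≤f n≤g =
    cong (n % b +_) (digitSumFuel-irrelevant f g (n / b) (/b<fuel n≤f) (/b<fuel n≤g))

  1+m%b<b : ∀ n → ¬ b ∣ suc n → suc (n % b) < b
  1+m%b<b n b∤1+n with m≤n⇒m<n∨m≡n (m%n<n n b)
  ... | inj₁ lt = lt
  ... | inj₂ eq = contradiction
        (divides (suc (n / b)) (trans (cong suc (m≡m%n+[m/n]*n n b)) (cong (_+ n / b * b) eq))) b∤1+n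

  digitSum-suc : ∀ n → ¬ b ∣ suc n → digitSum b (suc n) ≡ suc (digitSum b n)
  digitSum-suc zero       _      = refl
  digitSum-suc n@(suc n′) b∤1+n = begin
    suc n % b + digitSumFuel n b (suc n / b)
      ≡⟨ cong₂ _+_ (trans (%-distribˡ-+ 1 n b) (m<n⇒m%n≡m no-carry))
                   (cong (digitSumFuel n b) (+-distrib-/ 1 n no-carry)) ⟩
    suc (n % b) + digitSumFuel n b (n / b)
      ≡⟨ cong (λ s → suc (n % b + s)) (digitSumFuel-irrelevant n n′ (n / b) (m/n≤m n b) (/b<fuel ≤-refl)) ⟩
    suc (n % b + digitSumFuel n′ b (n / b))
      ∎
    where
    open ≡-Reasoning
    no-carry : suc (n % b) < b
    no-carry = 1+m%b<b n b∤1+n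

  thueMorse-suc : ∀ n → ¬ b ∣ suc n → t (suc n) ≡ σ (t n)
  thueMorse-suc n b∤1+n = cong (λ k → iter σ k α) (digitSum-suc n b∤1+n)

  thueMorse-suc-shifted : ∀ {ℓ n} → ¬ b ∣ ℓ → t n ≡ t (ℓ + n) → t (suc n) ≡ t (ℓ + suc n) →
                          t (ℓ + suc n) ≡ σ (t (ℓ + n))
  thueMorse-suc-shifted {ℓ} {n} b∤ℓ eq₀ eq₁ with b ∣? suc n
  ... | no  b∤1+n = trans (sym eq₁) (trans (thueMorse-suc n b∤1+n) (cong σ eq₀))
  ... | yes b∣1+n = subst (λ x → t x ≡ σ (t (ℓ + n))) (sym (+-suc ℓ n)) (thueMorse-suc (ℓ + n) b∤1+ℓ+n)
    where
    b∤1+ℓ+n : ¬ b ∣ suc (ℓ + n)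
    b∤1+ℓ+n b∣ = b∤ℓ (∣m+n∣m⇒∣n (subst (b ∣_) (sym (trans (+-comm (suc n) ℓ) (+-suc ℓ n))) b∣) b∣1+n)

  slice-period-sigmaCyclic : ∀ ℓ j L → ¬ b ∣ ℓ → IsPrefix (drop ℓ (slice t j L)) (slice t j L) →
                             SigmaCyclic σ (drop ℓ (slice t j L))
  slice-period-sigmaCyclic ℓ j L b∤ℓ period =
    subst (SigmaCyclic σ) (sym (drop-slice t ℓ j L)) (slice-sigmaCyclic t (ℓ + j) (L ∸ ℓ) step)
    where
    shifted : ∀ k → k < L ∸ ℓ → t (k + j) ≡ t (ℓ + (k + j))
    shifted k k< = trans
      (slice-isPrefix-pointwise t (subst (λ v → IsPrefix v (slice t j L)) (drop-slice t ℓ j L) period) k k<)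
      (cong t (x∙yz≈y∙xz k ℓ j))
    step : ∀ k → suc k < L ∸ ℓ → t (suc k + (ℓ + j)) ≡ σ (t (k + (ℓ + j)))
    step k 1+k< = subst₂ (λ x y → t x ≡ σ (t y)) (sym (x∙yz≈y∙xz (suc k) ℓ j)) (sym (x∙yz≈y∙xz k ℓ j))
      (thueMorse-suc-shifted b∤ℓ (shifted k (≤-trans (n≤1+n _) 1+k<)) (shifted (suc k) 1+k<))

  factor-period-sigmaCyclic : ∀ {ℓ} u → ¬ b ∣ ℓ → IsFactor t u → IsPrefix (drop ℓ u) u → SigmaCyclic σ (drop ℓ u)
  factor-period-sigmaCyclic {ℓ} u b∤ℓ (j , slice≡u) =
    subst (λ v → IsPrefix (drop ℓ v) v → SigmaCyclic σ (drop ℓ v)) slice≡u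
      (slice-period-sigmaCyclic ℓ j (length u) b∤ℓ)

lemma3p3 : (b : ℕ) → 2 ≤ b → (m : ℕ) → 1 ≤ m →
    (σ : Fin m → Fin m) → IsCyclicPerm σ → (α : Fin m) →
    (w : List (Fin m)) → IsFactor (thueMorse b σ α) w → ¬ (b ∣ length w) →
    ((p : List (Fin m)) → IsPrefix p w → IsFactor (thueMorse b σ α) (w ++ p) → SigmaCyclic σ p)
    × ((N : ℕ) → 2 * length w < N → IsFactor (thueMorse b σ α) (fracPow w N) → SigmaCyclic σ (fracPow w N))
lemma3p3 .(2 + c) (s≤s (s≤s {n = c} z≤n)) m _ σ _ α w _ b∤ℓ = prefix-power , fractional-power
  where
  open ThueMorse c σ α using (t; factor-period-sigmaCyclic)
  ℓ = length w

  prefix-power : ∀ p → IsPrefix p w → IsFactor t (w ++ p) → SigmaCyclic σ p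
  prefix-power p (s , w≡ps) factor =
    subst (SigmaCyclic σ) (drop-length-++ w p) (factor-period-sigmaCyclic (w ++ p) b∤ℓ factor period)
    where
    period : IsPrefix (drop ℓ (w ++ p)) (w ++ p)
    period = subst (λ v → IsPrefix v (w ++ p)) (sym (drop-length-++ w p))
               (s ++ p , trans (cong (_++ p) w≡ps) (++-assoc p s p))

  fractional-power : ∀ N → 2 * ℓ < N → IsFactor t (fracPow w N) → SigmaCyclic σ (fracPow w N)
  fractional-power N 2ℓ<N factor = subst (SigmaCyclic σ) (take++drop≡id ℓ u)
    (sigmaCyclic-border (take ℓ u) (drop ℓ u) border shorter
      (factor-period-sigmaCyclic u b∤ℓ factor (fracPow-period w N)))
    where
    u = fracPow w N
    instance
      ℓ≢0 : NonZero ℓ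
      ℓ≢0 = ≢-nonZero λ ℓ≡0 → b∤ℓ (subst (_ ∣_) (sym ℓ≡0) (_ ∣0))
    border : IsPrefix (drop ℓ u) (take ℓ u ++ drop ℓ u)
    border = subst (IsPrefix (drop ℓ u)) (sym (take++drop≡id ℓ u)) (fracPow-period w N)
    shorter : length (take ℓ u) < length (drop ℓ u)
    shorter = begin-strict
      length (take ℓ u) ≡⟨ length-take ℓ u ⟩
      ℓ ⊓ length u      ≤⟨ m⊓n≤m ℓ _ ⟩
      ℓ                 ≡⟨ sym (m+n∸n≡m ℓ ℓ) ⟩
      ℓ + ℓ ∸ ℓ         <⟨ ∸-monoˡ-< (subst (_< N) (cong (ℓ +_) (+-identityʳ ℓ)) 2ℓ<N) (m≤n+m ℓ ℓ) ⟩
      N ∸ ℓ             ≡⟨ cong (_∸ ℓ) (sym (length-fracPow w N)) ⟩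
      length u ∸ ℓ      ≡⟨ length-drop ℓ u ⟨
      length (drop ℓ u) ∎
      where open ≤-Reasoning
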